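{- Every $3\times 3$ minor of the distance matrix $D(G)$ of a connected bipartite graph $G$ is an even integer.
   Context: For a connected graph $G$, the distance matrix $D(G)$ has rows and columns indexed by the vertices, with $uv$-entry equal to the graph distance $d_G(u,v)$ (length of a shortest $u$–$v$ path). -}

module Defs where

open import Data.Nat using (ℕ; zero; suc; _<_)
open import Data.Fin using (Fin) renaming (zero to f0; suc to fs)
open import Data.Integer using (ℤ; +_; _+_; _-_; _*_)
open import Data.Bool using (Bool)
open import Data.Product using (Σ; ∃; _×_)
open import Relation.Nullary using (¬_)
open import Relation.Binary.PropositionalEquality using (_≡_; _≢_)
import Data.Fin as F

record SimpleGraph (n : ℕ) : Set₁ where
  field
    Adj   : Fin n → Fin n → Set
    sym   : ∀ {u v} → Adj u v → Adj v u
    irrefl : ∀ {u} → ¬ Adj u u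
open SimpleGraph public

data Walk {n : ℕ} (G : SimpleGraph n) : Fin n → Fin n → ℕ → Set where
  nil  : ∀ {u} → Walk G u u 0
  cons : ∀ {u w v k} → Adj G u w → Walk G w v k → Walk G u v (suc k)

Connected : ∀ {n} → SimpleGraph n → Set
Connected {n} G = ∀ (u v : Fin n) → ∃ λ k → Walk G u v k

Bipartite : ∀ {n} → SimpleGraph n → Set
Bipartite {n} G = Σ (Fin n → Bool) λ c → ∀ {u v} → Adj G u v → c u ≢ c v

IsDist : ∀ {n} → SimpleGraph n → Fin n → Fin n → ℕ → Set
IsDist G u v k = Walk G u v k × (∀ m → Walk G u v m → ¬ (m < k))

IsDistanceMatrix : ∀ {n} → SimpleGraph n → (Fin n → Fin n → ℕ) → Set
IsDistanceMatrix {n} G D = ∀ (u v : Fin n) → IsDist G u v (D u v)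

det3 : (Fin 3 → Fin 3 → ℤ) → ℤ
det3 M =
    a11 * (a22 * a33 - a23 * a32)
  - a12 * (a21 * a33 - a23 * a31)
  + a13 * (a21 * a32 - a22 * a31)
  where
    i1 i2 i3 : Fin 3
    i1 = f0
    i2 = fs f0
    i3 = fs (fs f0)
    a11 = M i1 i1
    a12 = M i1 i2
    a13 = M i1 i3
    a21 = M i2 i1
    a22 = M i2 i2
    a23 = M i2 i3
    a31 = M i3 i1
    a32 = M i3 i2
    a33 = M i3 i3

StrictlyIncreasing : ∀ {n} → (Fin 3 → Fin n) → Set
StrictlyIncreasing r = (r f0 F.< r (fs f0)) × (r (fs f0) F.< r (fs (fs f0)))

minor3 : ∀ {n} → (Fin n → Fin n → ℕ) → (Fin 3 → Fin n) → (Fin 3 → Fin n) → ℤ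
minor3 D r c = det3 (λ i j → + (D (r i) (c j)))

-- Colour the bipartite graph with f : V → {0, 1}.  Every walk from u to v
-- has length ≡ f u - f v (mod 2), so D(rᵢ, cⱼ) ≡ xᵢ - yⱼ (mod 2) with
-- xᵢ = f rᵢ and yⱼ = f cⱼ.  The matrix (xᵢ - yⱼ) has rank at most 2, so its
-- determinant vanishes, and determinants respect congruences.
module Submission where

open import Defs
open import Data.Nat using (ℕ; suc)
open import Data.Fin using (Fin) renaming (zero to f0; suc to fs)
open import Data.Integer using (ℤ; +_; _+_; _-_; _*_; -1ℤ; 0ℤ)
open import Data.Integer.Divisibility using (_∣_)

open import Data.Bool using (Bool; true; false)
open import Data.Empty using (⊥-elim)
open import Data.Integer.Properties using (+-identityʳ)
import Data.Integer.Divisibility.Signed as Signed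
open import Data.Integer.Divisibility.Signed
  using (divides; ∣⇒∣ᵤ; ∣m∣n⇒∣m+n; ∣m∣n⇒∣m-n; ∣n⇒∣m*n; ∣m⇒∣m*n)
open import Data.Integer.Tactic.RingSolver using (solve-∀)
open import Data.Product using (_,_; proj₁)
open import Function using (_∘_)
open import Relation.Binary.PropositionalEquality using (_≡_; _≢_; refl; subst)

-- A record rather than a synonym for m ∣ a - b: integer _*_ unfolds
-- eagerly, so a, b could not be inferred from the unfolded form.
infix 4 _≡_mod_
record _≡_mod_ (a b m : ℤ) : Set where
  constructor [_]
  field
    m∣a-b : m Signed.∣ a - b

module _ {m : ℤ} where

  +-cong-mod : ∀ {a b c d} → a ≡ b mod m → c ≡ d mod m → a + c ≡ b + d mod m
  +-cong-mod {a} {b} {c} {d} [ m∣a-b ] [ m∣c-d ] =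
    [ subst (m Signed.∣_) (regroup a b c d) (∣m∣n⇒∣m+n m∣a-b m∣c-d) ]
    where
    regroup : ∀ a b c d → (a - b) + (c - d) ≡ (a + c) - (b + d)
    regroup = solve-∀

  -‿cong-mod : ∀ {a b c d} → a ≡ b mod m → c ≡ d mod m → a - c ≡ b - d mod m
  -‿cong-mod {a} {b} {c} {d} [ m∣a-b ] [ m∣c-d ] =
    [ subst (m Signed.∣_) (regroup a b c d) (∣m∣n⇒∣m-n m∣a-b m∣c-d) ]
    where
    regroup : ∀ a b c d → (a - b) - (c - d) ≡ (a - c) - (b - d)
    regroup = solve-∀

  *-cong-mod : ∀ {a b c d} → a ≡ b mod m → c ≡ d mod m → a * c ≡ b * d mod m
  *-cong-mod {a} {b} {c} {d} [ m∣a-b ] [ m∣c-d ] =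
    [ subst (m Signed.∣_) (regroup a b c d) (∣m∣n⇒∣m+n (∣m⇒∣m*n c m∣a-b) (∣n⇒∣m*n b m∣c-d)) ]
    where
    regroup : ∀ a b c d → (a - b) * c + b * (c - d) ≡ a * c - b * d
    regroup = solve-∀

  ≡0-mod⇒∣ : ∀ {a} → a ≡ + 0 mod m → m Signed.∣ a
  ≡0-mod⇒∣ {a} [ m∣a-0 ] = subst (m Signed.∣_) (+-identityʳ a) m∣a-0

  det3-cong-mod : ∀ {M N : Fin 3 → Fin 3 → ℤ} → (∀ i j → M i j ≡ N i j mod m) →
                  det3 M ≡ det3 N mod m
  det3-cong-mod {M} {N} M≡N =
    +-cong-mod (-‿cong-mod (*-cong-mod (M≡N i₁ i₁) (minor i₂ i₃ i₂ i₃))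
                           (*-cong-mod (M≡N i₁ i₂) (minor i₁ i₃ i₂ i₃)))
               (*-cong-mod (M≡N i₁ i₃) (minor i₁ i₂ i₂ i₃))
    where
    i₁ i₂ i₃ : Fin 3
    i₁ = f0
    i₂ = fs f0
    i₃ = fs (fs f0)
    minor : ∀ j k i i′ → M i j * M i′ k - M i k * M i′ j ≡ N i j * N i′ k - N i k * N i′ j mod m
    minor j k i i′ =
      -‿cong-mod (*-cong-mod (M≡N i j) (M≡N i′ k)) (*-cong-mod (M≡N i k) (M≡N i′ j))

det3[xᵢ-yⱼ]≡0 : (x y : Fin 3 → ℤ) → det3 (λ i j → x i - y j) ≡ + 0
det3[xᵢ-yⱼ]≡0 x y = expanded (x f0) (x (fs f0)) (x (fs (fs f0))) (y f0) (y (fs f0)) (y (fs (fs f0)))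
  where
  expanded : ∀ a b c d e f →
      (a - d) * ((b - e) * (c - f) - (b - f) * (c - e))
    - (a - e) * ((b - d) * (c - f) - (b - f) * (c - d))
    + (a - f) * ((b - d) * (c - e) - (b - e) * (c - d)) ≡ + 0
  expanded = solve-∀

walk-length≡potential-difference :
  ∀ {n} (G : SimpleGraph n) {m} (f : Fin n → ℤ) →
  (∀ {u w} → Adj G u w → f u ≡ f w + + 1 mod m) →
  ∀ {u v k} → Walk G u v k → + k ≡ f u - f v mod m
walk-length≡potential-difference G {m} f step {u} nil =
  [ divides 0ℤ (cancel (f u) m) ]
  where
  cancel : ∀ x k → + 0 - (x - x) ≡ + 0 * k
  cancel = solve-∀
walk-length≡potential-difference G {m} f step {u} {v} {suc k} (cons {w = w} u~w walk)
  with [ m∣k-[fw-fv] ] ← walk-length≡potential-difference G f step walk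
     | [ m∣fu-[fw+1] ] ← step u~w =
  [ subst (m Signed.∣_) (regroup (+ k) (f u) (f w) (f v)) (∣m∣n⇒∣m-n m∣k-[fw-fv] m∣fu-[fw+1]) ]
  where
  regroup : ∀ k fu fw fv → (k - (fw - fv)) - (fu - (fw + + 1)) ≡ (+ 1 + k) - (fu - fv)
  regroup = solve-∀

toℤ : Bool → ℤ
toℤ false = + 0
toℤ true  = + 1

toℤ-≢ : ∀ {a b} → a ≢ b → toℤ a ≡ toℤ b + + 1 mod + 2
toℤ-≢ {false} {false} a≢b = ⊥-elim (a≢b refl)
toℤ-≢ {false} {true}  _   = [ divides -1ℤ refl ]
toℤ-≢ {true}  {false} _   = [ divides 0ℤ refl ]
toℤ-≢ {true}  {true}  a≢b = ⊥-elim (a≢b refl)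

mainTheorem4 : ∀ (n : ℕ) (G : SimpleGraph n) → Connected G → Bipartite G →
    (D : Fin n → Fin n → ℕ) → IsDistanceMatrix G D →
    (r c : Fin 3 → Fin n) → StrictlyIncreasing r → StrictlyIncreasing c →
    + 2 ∣ minor3 D r c
mainTheorem4 n G _ (colour , proper) D isDist r c _ _ = ∣⇒∣ᵤ (≡0-mod⇒∣ minor≡0)
  where
  f : Fin n → ℤ
  f = toℤ ∘ colour

  D≡f-f : ∀ u v → + D u v ≡ f u - f v mod + 2
  D≡f-f u v = walk-length≡potential-difference G f (toℤ-≢ ∘ proper) (proj₁ (isDist u v))

  minor≡det3[xᵢ-yⱼ] : minor3 D r c ≡ det3 (λ i j → f (r i) - f (c j)) mod + 2
  minor≡det3[xᵢ-yⱼ] = det3-cong-mod (λ i j → D≡f-f (r i) (c j))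

  minor≡0 : minor3 D r c ≡ + 0 mod + 2
  minor≡0 = subst (minor3 D r c ≡_mod + 2) (det3[xᵢ-yⱼ]≡0 (f ∘ r) (f ∘ c)) minor≡det3[xᵢ-yⱼ]
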